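{- Let $k\geq 1$ be an integer. Then (a) there exist a positive integer $v$ and a connected symmetric configuration $v_3$ whose minimum blocking set cardinality is exactly $\lceil v/3\rceil+k$; and (b) there exist a positive integer $v$ and a connected symmetric configuration $v_3$ whose minimum blocking set cardinality is exactly $\lfloor v/2\rfloor-k$.
   Context: A symmetric configuration $v_3$ is a finite incidence structure consisting of a set $V$ of $v$ points and a collection of $v$ blocks, each block a $3$-element subset of $V$, such that each point lies in exactly $3$ blocks and any two distinct points lie together in at most one block. It is connected if it is not the union of two configurations on disjoint point sets. A blocking set is a subset $Q\subseteq V$ such that every block contains at least one point of $Q$ and at least one point of $V\setminus Q$; the minimum blocking set cardinality is the least size of a blocking set. -}

module Defs where

open import Data.Nat using (ℕ; _+_; _≤_; _/_)
open import Data.Bool using (_∧_)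
open import Data.Fin using (Fin)
open import Data.Fin.Subset using (Subset; _⊆_; ∣_∣; Nonempty; Empty; _∩_; ∁; ⊤)
open import Data.Vec using (tabulate; lookup)
open import Data.Product using (Σ; _×_)
open import Data.Sum using (_⊎_)
open import Relation.Binary.PropositionalEquality using (_≡_; _≢_)

blocksThrough : {v : ℕ} → (Fin v → Subset v) → Fin v → ℕ
blocksThrough B x = ∣ tabulate (λ i → lookup (B i) x) ∣

blocksThrough₂ : {v : ℕ} → (Fin v → Subset v) → Fin v → Fin v → ℕ
blocksThrough₂ B x y = ∣ tabulate (λ i → lookup (B i) x ∧ lookup (B i) y) ∣

record Config (v : ℕ) : Set where
  field
    block      : Fin v → Subset v
    blockSize  : ∀ i → ∣ block i ∣ ≡ 3
    pointDeg   : ∀ x → blocksThrough block x ≡ 3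
    pairCond   : ∀ x y → x ≢ y → blocksThrough₂ block x y ≤ 1
open Config public

-- Connected: the configuration is not the union of two configurations on
-- disjoint (nonempty) point sets, i.e. there is no point set S with S and its
-- complement both nonempty such that every block lies inside S or inside ∁ S.
Connected : {v : ℕ} → Config v → Set
Connected {v} C =
  (S : Subset v) → (∀ i → (block C i ⊆ S) ⊎ (block C i ⊆ ∁ S)) →
  Empty S ⊎ Empty (∁ S)

IsBlockingSet : {v : ℕ} → Config v → Subset v → Set
IsBlockingSet C Q = ∀ i → Nonempty (block C i ∩ Q) × Nonempty (block C i ∩ ∁ Q)

MinBlockingSize : {v : ℕ} → Config v → ℕ → Set
MinBlockingSize {v} C m =
  Σ (Subset v) (λ Q → IsBlockingSet C Q × ∣ Q ∣ ≡ m) ×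
  (∀ (Q : Subset v) → IsBlockingSet C Q → m ≤ ∣ Q ∣)

ceil3 : ℕ → ℕ
ceil3 v = (v + 2) / 3

-- Both families come from one construction. Take a configuration C on s points, a block D of C
-- and a point d ∈ D, and glue N copies of C in a cycle: in copy g the block D takes its point d
-- from copy g − 1, every other block stays inside its copy. This twisted cover is again a
-- configuration v₃ with v = N·s. If no nontrivial 2-colouring of C is monochromatic on every
-- block except D, each copy is monochromatic under a colouring of the cover that respects all
-- blocks, and the twisted blocks force consecutive copies to agree, so the cover is connected.
-- A blocking set of the cover meets each copy in a set splitting every block of C except D; if
-- all such sets have at least m points while C has a blocking set of size m, the minimum blocking
-- set of the cover has exactly N·m points. A 12-point configuration with m = 5 and a 10-point
-- one with m = 4, both certified by exhaustive search, give N·m = ⌈v/3⌉ + N and ⌊v/2⌋ − N.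
module Submission where

open import Defs
open import Data.Nat using (ℕ; zero; suc; _+_; _*_; _≤_; _/_; _>_; z≤n; s≤s; _≤?_)
  renaming (_≟_ to _≟ℕ_)
open import Data.Nat.Properties using (+-mono-≤; ≤-trans; ≤-antisym; +-comm; +-identityʳ; *-suc; *-assoc)
open import Data.Nat.DivMod using (m*n/n≡m; +-distrib-/-∣ˡ)
open import Data.Nat.Divisibility using (divides-refl)
open import Data.Bool using (Bool; true; false; not; _∧_)
open import Data.Fin using (Fin; zero; suc; _↑ˡ_; _↑ʳ_; combine; remQuot; fromℕ; inject₁; _≟_; #_)
open import Data.Fin.Properties
  using (0≢1+n; suc-injective; remQuot-combine; combine-remQuot; combine-injectiveʳ; all?)
open import Data.Fin.Induction using (<-weakInduction)
open import Data.Fin.Subset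
  using (Subset; inside; outside; _∈_; _⊆_; _-_; ∣_∣; ⁅_⁆; _∪_; _∩_; ∁; Nonempty; Empty)
open import Data.Fin.Subset.Properties
  using ( _∈?_; nonempty?; anySubset?; x∈p⇒∣p-x∣<∣p∣; x∈p∧x≢y⇒x∈p-y; x∈p∩q⁺; x∈p∩q⁻
        ; x∈p∪q⁺; x∈p∪q⁻; x∈⁅x⁆; x∈⁅y⁆⇒x≡y; x∈p⇒x∉∁p; x∈∁p⇒x∉p; x∉∁p⇒x∈p; Empty-unique; ∣⊥∣≡0)
open import Data.Vec using ([]; _∷_; tabulate; lookup; map; here; there)
open import Data.Vec.Properties
  using (lookup∘tabulate; tabulate∘lookup; tabulate-cong; tabulate-∘; lookup-map; []=⇒lookup; lookup⇒[]=)
open import Data.Product using (Σ; _×_; _,_; proj₁; proj₂)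
open import Data.Sum using (_⊎_; inj₁; inj₂)
open import Function using (_∘′_; id; mk⇔)
open import Level using (Level)
open import Relation.Nullary using (¬_; Dec; yes; no; does; ¬?; contradiction)
open import Relation.Nullary.Decidable
  using (True; _×-dec_; _⊎-dec_; _→-dec_; map′; from-yes; toWitness; decidable-stable; dec-true; dec-false; does-⇔)
open import Relation.Unary using (Pred; Decidable)
open import Relation.Binary.PropositionalEquality

private variable
  ℓ : Level
  k m n s v : ℕ

∣p∣≤∣q∣-by-injection : (p : Subset m) (q : Subset n) (f : Fin m → Fin n) →
  (∀ {x} → x ∈ p → f x ∈ q) → (∀ {x y} → x ∈ p → y ∈ p → f x ≡ f y → x ≡ y) →
  ∣ p ∣ ≤ ∣ q ∣
∣p∣≤∣q∣-by-injection [] q f _ _ = z≤n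
∣p∣≤∣q∣-by-injection (outside ∷ p) q f maps inj =
  ∣p∣≤∣q∣-by-injection p q (f ∘′ suc) (maps ∘′ there) (λ x∈ y∈ → suc-injective ∘′ inj (there x∈) (there y∈))
∣p∣≤∣q∣-by-injection (inside ∷ p) q f maps inj =
  ≤-trans (s≤s (∣p∣≤∣q∣-by-injection p (q - f zero) (f ∘′ suc) maps-q-f0 inj-suc)) (x∈p⇒∣p-x∣<∣p∣ (maps here))
  where
  inj-suc : ∀ {x y} → x ∈ p → y ∈ p → f (suc x) ≡ f (suc y) → x ≡ y
  inj-suc x∈ y∈ = suc-injective ∘′ inj (there x∈) (there y∈)
  maps-q-f0 : ∀ {x} → x ∈ p → f (suc x) ∈ q - f zero
  maps-q-f0 x∈p = x∈p∧x≢y⇒x∈p-y (maps (there x∈p)) (λ eq → 0≢1+n (inj here (there x∈p) (sym eq)))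

Empty⇒∣p∣≡0 : {p : Subset n} → Empty p → ∣ p ∣ ≡ 0
Empty⇒∣p∣≡0 {n} e = trans (cong ∣_∣ (Empty-unique e)) (∣⊥∣≡0 n)

∣tabulate∣-++ : ∀ m {n} (f : Fin (m + n) → Bool) →
  ∣ tabulate f ∣ ≡ ∣ tabulate (f ∘′ (_↑ˡ n)) ∣ + ∣ tabulate (f ∘′ (m ↑ʳ_)) ∣
∣tabulate∣-++ zero f = refl
∣tabulate∣-++ (suc m) f with f zero
... | true = cong suc (∣tabulate∣-++ m (f ∘′ suc))
... | false = ∣tabulate∣-++ m (f ∘′ suc)

*≤∣tabulate∣ : ∀ m (f : Fin (m * s) → Bool) →
  (∀ (g : Fin m) → k ≤ ∣ tabulate (λ (r : Fin s) → f (combine g r)) ∣) → m * k ≤ ∣ tabulate f ∣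
*≤∣tabulate∣ zero f _ = z≤n
*≤∣tabulate∣ {s = s} (suc m) f bound = subst (_ ≤_) (sym (∣tabulate∣-++ s f))
  (+-mono-≤ (bound zero) (*≤∣tabulate∣ m (f ∘′ (s ↑ʳ_)) (λ g → bound (suc g))))

∣tabulate∣≡* : ∀ m (f : Fin (m * s) → Bool) →
  (∀ (g : Fin m) → ∣ tabulate (λ (r : Fin s) → f (combine g r)) ∣ ≡ k) → ∣ tabulate f ∣ ≡ m * k
∣tabulate∣≡* zero f _ = refl
∣tabulate∣≡* {s = s} (suc m) f size = trans (∣tabulate∣-++ s f)
  (cong₂ _+_ (size zero) (∣tabulate∣≡* m (f ∘′ (s ↑ʳ_)) (λ g → size (suc g))))

∈-tabulate⁺ : {f : Fin n → Bool} {x : Fin n} → f x ≡ true → x ∈ tabulate f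
∈-tabulate⁺ {f = f} {x} fx = lookup⇒[]= x (tabulate f) (trans (lookup∘tabulate f x) fx)

∈-tabulate⁻ : {f : Fin n → Bool} {x : Fin n} → x ∈ tabulate f → f x ≡ true
∈-tabulate⁻ {f = f} {x} x∈ = trans (sym (lookup∘tabulate f x)) ([]=⇒lookup x∈)

∈-tabulate-does⁺ : {P : Pred (Fin n) ℓ} (P? : Decidable P) {x : Fin n} →
  P x → x ∈ tabulate (λ x → does (P? x))
∈-tabulate-does⁺ P? {x} px = ∈-tabulate⁺ (dec-true (P? x) px)

∈-tabulate-does⁻ : {P : Pred (Fin n) ℓ} (P? : Decidable P) {x : Fin n} →
  x ∈ tabulate (λ x → does (P? x)) → P x
∈-tabulate-does⁻ P? {x} x∈ with P? x | ∈-tabulate⁻ {f = λ x → does (P? x)} x∈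
... | yes px | _ = px

preimage : (Fin m → Fin n) → Subset n → Subset m
preimage f Q = tabulate (lookup Q ∘′ f)

∈-preimage⁺ : {f : Fin m → Fin n} {Q : Subset n} {x : Fin m} → f x ∈ Q → x ∈ preimage f Q
∈-preimage⁺ = ∈-tabulate⁺ ∘′ []=⇒lookup

∈-preimage⁻ : {f : Fin m → Fin n} {Q : Subset n} {x : Fin m} → x ∈ preimage f Q → f x ∈ Q
∈-preimage⁻ {f = f} {Q} {x} = lookup⇒[]= (f x) Q ∘′ ∈-tabulate⁻

∁-preimage : (f : Fin m → Fin n) (Q : Subset n) → ∁ (preimage f Q) ≡ preimage f (∁ Q)
∁-preimage f Q = begin
  map not (tabulate (lookup Q ∘′ f))  ≡⟨ tabulate-∘ not (lookup Q ∘′ f) ⟨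
  tabulate (not ∘′ lookup Q ∘′ f)     ≡⟨ tabulate-cong (λ x → lookup-map (f x) not Q) ⟨
  tabulate (lookup (∁ Q) ∘′ f)        ∎
  where open ≡-Reasoning

pencil : (Fin m → Subset n) → Fin n → Subset m
pencil B x = tabulate (λ i → lookup (B i) x)

pencil₂ : (Fin m → Subset n) → Fin n → Fin n → Subset m
pencil₂ B x y = tabulate (λ i → lookup (B i) x ∧ lookup (B i) y)

∈-pencil⁺ : (B : Fin m → Subset n) {i : Fin m} {x : Fin n} → x ∈ B i → i ∈ pencil B x
∈-pencil⁺ B = ∈-tabulate⁺ ∘′ []=⇒lookup

∈-pencil⁻ : (B : Fin m → Subset n) {i : Fin m} {x : Fin n} → i ∈ pencil B x → x ∈ B i
∈-pencil⁻ B {i} {x} = lookup⇒[]= x (B i) ∘′ ∈-tabulate⁻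

∈-pencil₂⁺ : (B : Fin m → Subset n) {i : Fin m} {x y : Fin n} → x ∈ B i → y ∈ B i → i ∈ pencil₂ B x y
∈-pencil₂⁺ B x∈ y∈ = ∈-tabulate⁺ (cong₂ _∧_ ([]=⇒lookup x∈) ([]=⇒lookup y∈))

∈-pencil₂⁻ : (B : Fin m → Subset n) {i : Fin m} {x y : Fin n} → i ∈ pencil₂ B x y → x ∈ B i × y ∈ B i
∈-pencil₂⁻ B {i} {x} {y} i∈ with lookup (B i) x in ex | lookup (B i) y in ey | ∈-tabulate⁻ i∈
... | true | true | _ = lookup⇒[]= x (B i) ex , lookup⇒[]= y (B i) ey

Splits : Subset n → Subset n → Set
Splits Q b = Nonempty (b ∩ Q) × Nonempty (b ∩ ∁ Q)

BlockingExcept : Config v → Fin v → Subset v → Set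
BlockingExcept C D Q = ∀ c → c ≢ D → Splits Q (block C c)

-- Connectedness of C with the block D deleted, phrased with ¬ Splits where Connected uses ⊆.
ConnectedExcept : Config v → Fin v → Set
ConnectedExcept C D = ∀ S → (∀ c → c ≢ D → ¬ Splits S (block C c)) → Empty S ⊎ Empty (∁ S)

monochromatic⇒¬splits : {S b : Subset n} → b ⊆ S ⊎ b ⊆ ∁ S → ¬ Splits S b
monochromatic⇒¬splits {S = S} {b} (inj₁ b⊆S) (_ , x , x∈) =
  let x∈b , x∈∁S = x∈p∩q⁻ b (∁ S) x∈ in x∈∁p⇒x∉p x∈∁S (b⊆S x∈b)
monochromatic⇒¬splits {S = S} {b} (inj₂ b⊆∁S) ((x , x∈) , _) =
  let x∈b , x∈S = x∈p∩q⁻ b S x∈ in x∈p⇒x∉∁p x∈S (b⊆∁S x∈b)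

monochromatic⇒∈?-≡ : {S b : Subset n} {x y : Fin n} → b ⊆ S ⊎ b ⊆ ∁ S → x ∈ b → y ∈ b →
  does (x ∈? S) ≡ does (y ∈? S)
monochromatic⇒∈?-≡ {S = S} {x = x} {y} (inj₁ b⊆S) x∈b y∈b =
  trans (dec-true (x ∈? S) (b⊆S x∈b)) (sym (dec-true (y ∈? S) (b⊆S y∈b)))
monochromatic⇒∈?-≡ {S = S} {x = x} {y} (inj₂ b⊆∁S) x∈b y∈b =
  trans (dec-false (x ∈? S) (x∈∁p⇒x∉p (b⊆∁S x∈b)))
        (sym (dec-false (y ∈? S) (x∈∁p⇒x∉p (b⊆∁S y∈b))))

trivial⇒∈?-≡ : {S : Subset n} (x y : Fin n) → Empty S ⊎ Empty (∁ S) → does (x ∈? S) ≡ does (y ∈? S)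
trivial⇒∈?-≡ {S = S} x y (inj₁ ∅S) =
  trans (dec-false (x ∈? S) (λ x∈ → ∅S (x , x∈))) (sym (dec-false (y ∈? S) (λ y∈ → ∅S (y , y∈))))
trivial⇒∈?-≡ {S = S} x y (inj₂ ∅∁S) =
  trans (dec-true (x ∈? S) (inside′ x)) (sym (dec-true (y ∈? S) (inside′ y)))
  where
  inside′ : ∀ z → z ∈ S
  inside′ z = x∉∁p⇒x∈p (λ z∈ → ∅∁S (z , z∈))

prev : Fin (suc n) → Fin (suc n)
prev {n} zero = fromℕ n
prev (suc i) = inject₁ i

next : Fin (suc n) → Fin (suc n)
next {zero} zero = zero
next {suc n} zero = suc zero
next {suc n} (suc i) with next i
... | zero = zero
... | suc j = suc (suc j)

prev-next : (i : Fin (suc n)) → prev (next i) ≡ i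
prev-next {zero} zero = refl
prev-next {suc n} zero = refl
prev-next {suc n} (suc i) with next i | prev-next i
... | zero | eq = cong suc eq
... | suc j | eq = cong suc eq

next-fromℕ : ∀ n → next (fromℕ n) ≡ zero
next-fromℕ zero = refl
next-fromℕ (suc n) rewrite next-fromℕ n = refl

next-inject₁ : (i : Fin n) → next (inject₁ i) ≡ suc i
next-inject₁ {suc n} zero = refl
next-inject₁ {suc n} (suc i) rewrite next-inject₁ i = refl

next-prev : (i : Fin (suc n)) → next (prev i) ≡ i
next-prev {n} zero = next-fromℕ n
next-prev (suc i) = next-inject₁ i

-- The twisted cyclic cover

module TwistedCover {s : ℕ} (C : Config s) (D d : Fin s) (n : ℕ) where

  Copy : Set
  Copy = Fin (suc n)

  shift : Fin s → Fin s → Copy → Copy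
  shift c r with c ≟ D ×-dec r ≟ d
  ... | yes _ = prev
  ... | no _ = id

  unshift : Fin s → Fin s → Copy → Copy
  unshift c r with c ≟ D ×-dec r ≟ d
  ... | yes _ = next
  ... | no _ = id

  shift-unshift : ∀ c r g → shift c r (unshift c r g) ≡ g
  shift-unshift c r g with c ≟ D ×-dec r ≟ d
  ... | yes _ = prev-next g
  ... | no _ = refl

  shift-injective : ∀ c r {g g′} → shift c r g ≡ shift c r g′ → g ≡ g′
  shift-injective c r {g} {g′} eq with c ≟ D ×-dec r ≟ d
  ... | yes _ = trans (sym (next-prev g)) (trans (cong next eq) (next-prev g′))
  ... | no _ = eq

  shift-untwisted : ∀ c r {g} → ¬ (c ≡ D × r ≡ d) → shift c r g ≡ g
  shift-untwisted c r untwisted with c ≟ D ×-dec r ≟ d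
  ... | yes twisted = contradiction twisted untwisted
  ... | no _ = refl

  shift-twisted : ∀ {g} → shift D d g ≡ prev g
  shift-twisted with D ≟ D ×-dec d ≟ d
  ... | yes _ = refl
  ... | no untwisted = contradiction (refl , refl) untwisted

  Index : Set
  Index = Fin (suc n * s)

  copy : Index → Copy
  copy p = proj₁ (remQuot {suc n} s p)

  residue : Index → Fin s
  residue p = proj₂ (remQuot {suc n} s p)

  copy-combine : ∀ g r → copy (combine g r) ≡ g
  copy-combine g r = cong proj₁ (remQuot-combine g r)

  residue-combine : ∀ g r → residue (combine g r) ≡ r
  residue-combine g r = cong proj₂ (remQuot-combine g r)

  combine-copy-residue : ∀ p → combine (copy p) (residue p) ≡ p
  combine-copy-residue = combine-remQuot {suc n} s

  ≡-by-copy-residue : ∀ {p q} → copy p ≡ copy q → residue p ≡ residue q → p ≡ q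
  ≡-by-copy-residue {p} {q} copy≡ residue≡ = begin
    p                              ≡⟨ combine-copy-residue p ⟨
    combine (copy p) (residue p)   ≡⟨ cong₂ combine copy≡ residue≡ ⟩
    combine (copy q) (residue q)   ≡⟨ combine-copy-residue q ⟩
    q                              ∎
    where open ≡-Reasoning

  -- Block (g, c) consists of the points (shift c r g, r) with r ∈ c.
  Incident : Copy → Fin s → Index → Set
  Incident g c p = residue p ∈ block C c × copy p ≡ shift c (residue p) g

  incident? : ∀ g c p → Dec (Incident g c p)
  incident? g c p = residue p ∈? block C c ×-dec copy p ≟ shift c (residue p) g

  coverBlock : Index → Subset (suc n * s)
  coverBlock i = tabulate (λ p → does (incident? (copy i) (residue i) p))

  ∈-coverBlock⁺ : ∀ {i p} → Incident (copy i) (residue i) p → p ∈ coverBlock i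
  ∈-coverBlock⁺ {i} = ∈-tabulate-does⁺ (incident? (copy i) (residue i))

  ∈-coverBlock⁻ : ∀ {i p} → p ∈ coverBlock i → Incident (copy i) (residue i) p
  ∈-coverBlock⁻ {i} = ∈-tabulate-does⁻ (incident? (copy i) (residue i))

  ∈-combine⁺ : ∀ g c {p} → Incident g c p → p ∈ coverBlock (combine g c)
  ∈-combine⁺ g c {p} = ∈-coverBlock⁺ ∘′
    subst₂ (λ g′ c′ → Incident g′ c′ p) (sym (copy-combine g c)) (sym (residue-combine g c))

  ∈-combine⁻ : ∀ g c {p} → p ∈ coverBlock (combine g c) → Incident g c p
  ∈-combine⁻ g c {p} =
    subst₂ (λ g′ c′ → Incident g′ c′ p) (copy-combine g c) (residue-combine g c) ∘′ ∈-coverBlock⁻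

  incident-combine : ∀ {g c g′ r} → r ∈ block C c → g′ ≡ shift c r g → Incident g c (combine g′ r)
  incident-combine {g} {c} {g′} {r} r∈c g′≡ =
    subst (λ r′ → r′ ∈ block C c × copy (combine g′ r) ≡ shift c r′ g) (sym (residue-combine g′ r))
      (r∈c , trans (copy-combine g′ r) g′≡)

  pointOver : Index → Fin s → Index
  pointOver i r = combine (shift (residue i) r (copy i)) r

  blockOver : Index → Fin s → Index
  blockOver x c = combine (unshift c (residue x) (copy x)) c

  residue-pointOver : ∀ i r → residue (pointOver i r) ≡ r
  residue-pointOver i r = residue-combine (shift (residue i) r (copy i)) r

  pointOver-∈ : ∀ {i r} → r ∈ block C (residue i) → pointOver i r ∈ coverBlock i
  pointOver-∈ r∈ = ∈-coverBlock⁺ (incident-combine r∈ refl)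

  blockOver-∋ : ∀ {x c} → residue x ∈ block C c → x ∈ coverBlock (blockOver x c)
  blockOver-∋ {x} {c} r∈ = ∈-combine⁺ _ c (r∈ , sym (shift-unshift c (residue x) (copy x)))

  residue-injective-on-block : ∀ {i p q} → p ∈ coverBlock i → q ∈ coverBlock i → residue p ≡ residue q → p ≡ q
  residue-injective-on-block {i} p∈ q∈ eq = ≡-by-copy-residue
    (trans (proj₂ (∈-coverBlock⁻ p∈))
      (trans (cong (λ r → shift (residue i) r (copy i)) eq) (sym (proj₂ (∈-coverBlock⁻ q∈)))))
    eq

  residue-injective-on-pencil : ∀ {x i j} → x ∈ coverBlock i → x ∈ coverBlock j → residue i ≡ residue j → i ≡ j
  residue-injective-on-pencil {x} {i} {j} x∈i x∈j eq = ≡-by-copy-residue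
    (shift-injective (residue i) (residue x) (trans (sym (proj₂ (∈-coverBlock⁻ x∈i)))
      (trans (proj₂ (∈-coverBlock⁻ x∈j)) (cong (λ c → shift c (residue x) (copy j)) (sym eq)))))
    eq

  coverBlock-size : ∀ i → ∣ coverBlock i ∣ ≡ 3
  coverBlock-size i = trans (≤-antisym to-block from-block) (blockSize C (residue i))
    where
    to-block : ∣ coverBlock i ∣ ≤ ∣ block C (residue i) ∣
    to-block = ∣p∣≤∣q∣-by-injection (coverBlock i) (block C (residue i)) residue
      (proj₁ ∘′ ∈-coverBlock⁻) residue-injective-on-block
    from-block : ∣ block C (residue i) ∣ ≤ ∣ coverBlock i ∣
    from-block = ∣p∣≤∣q∣-by-injection (block C (residue i)) (coverBlock i) (pointOver i) pointOver-∈
      (λ {r} {r′} _ _ eq → trans (sym (residue-pointOver i r)) (trans (cong residue eq) (residue-pointOver i r′)))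

  pencil-size : ∀ x → ∣ pencil coverBlock x ∣ ≡ 3
  pencil-size x = trans (≤-antisym to-pencil from-pencil) (pointDeg C (residue x))
    where
    to-pencil : ∣ pencil coverBlock x ∣ ≤ ∣ pencil (block C) (residue x) ∣
    to-pencil = ∣p∣≤∣q∣-by-injection (pencil coverBlock x) (pencil (block C) (residue x)) residue
      (∈-pencil⁺ (block C) ∘′ proj₁ ∘′ ∈-coverBlock⁻ ∘′ ∈-pencil⁻ coverBlock)
      (λ i∈ j∈ → residue-injective-on-pencil (∈-pencil⁻ coverBlock i∈) (∈-pencil⁻ coverBlock j∈))
    from-pencil : ∣ pencil (block C) (residue x) ∣ ≤ ∣ pencil coverBlock x ∣
    from-pencil = ∣p∣≤∣q∣-by-injection (pencil (block C) (residue x)) (pencil coverBlock x) (blockOver x)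
      (∈-pencil⁺ coverBlock ∘′ blockOver-∋ ∘′ ∈-pencil⁻ (block C))
      (λ {c} {c′} _ _ → combine-injectiveʳ (unshift c (residue x) (copy x)) c (unshift c′ (residue x) (copy x)) c′)

  pencil₂-size : ∀ x y → x ≢ y → ∣ pencil₂ coverBlock x y ∣ ≤ 1
  pencil₂-size x y x≢y with residue x ≟ residue y
  ... | yes eq = subst (_≤ 1) (sym (Empty⇒∣p∣≡0 λ (i , i∈) →
    let x∈ , y∈ = ∈-pencil₂⁻ coverBlock i∈ in x≢y (residue-injective-on-block x∈ y∈ eq))) z≤n
  ... | no r≢r′ = ≤-trans
    (∣p∣≤∣q∣-by-injection (pencil₂ coverBlock x y) (pencil₂ (block C) (residue x) (residue y)) residue
      to-local injective)
    (pairCond C (residue x) (residue y) r≢r′)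
    where
    to-local : ∀ {i} → i ∈ pencil₂ coverBlock x y → residue i ∈ pencil₂ (block C) (residue x) (residue y)
    to-local i∈ = let x∈ , y∈ = ∈-pencil₂⁻ coverBlock i∈ in
      ∈-pencil₂⁺ (block C) (proj₁ (∈-coverBlock⁻ x∈)) (proj₁ (∈-coverBlock⁻ y∈))
    injective : ∀ {i j} → i ∈ pencil₂ coverBlock x y → j ∈ pencil₂ coverBlock x y →
      residue i ≡ residue j → i ≡ j
    injective i∈ j∈ =
      residue-injective-on-pencil (proj₁ (∈-pencil₂⁻ coverBlock i∈)) (proj₁ (∈-pencil₂⁻ coverBlock j∈))

  cover : Config (suc n * s)
  cover = record
    { block = coverBlock ; blockSize = coverBlock-size ; pointDeg = pencil-size ; pairCond = pencil₂-size }

  slice : Subset (suc n * s) → Copy → Subset s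
  slice Q g = preimage (combine g) Q

  ∈?-slice : ∀ S g r → does (r ∈? slice S g) ≡ does (combine g r ∈? S)
  ∈?-slice S g r = does-⇔ (mk⇔ ∈-preimage⁻ ∈-preimage⁺) (r ∈? slice S g) (combine g r ∈? S)

  meets-untwisted⁺ : ∀ g {c} P → c ≢ D →
    Nonempty (block C c ∩ slice P g) → Nonempty (coverBlock (combine g c) ∩ P)
  meets-untwisted⁺ g {c} P c≢D (r , r∈) with x∈p∩q⁻ (block C c) (slice P g) r∈
  ... | r∈c , r∈P = combine g r , x∈p∩q⁺ (∈-combine⁺ g c incident , ∈-preimage⁻ r∈P)
    where
    incident : Incident g c (combine g r)
    incident = incident-combine r∈c (sym (shift-untwisted c r (c≢D ∘′ proj₁)))

  meets-untwisted⁻ : ∀ g {c} P → c ≢ D →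
    Nonempty (coverBlock (combine g c) ∩ P) → Nonempty (block C c ∩ slice P g)
  meets-untwisted⁻ g {c} P c≢D (p , p∈) with x∈p∩q⁻ (coverBlock (combine g c)) P p∈
  ... | p∈b , p∈P with ∈-combine⁻ g c p∈b
  ... | r∈c , copy≡ = residue p , x∈p∩q⁺ (r∈c , ∈-preimage⁺ (subst (_∈ P) p≡ p∈P))
    where
    p≡ : p ≡ combine g (residue p)
    p≡ = ≡-by-copy-residue
           (trans (trans copy≡ (shift-untwisted c (residue p) (c≢D ∘′ proj₁))) (sym (copy-combine g (residue p))))
           (sym (residue-combine g (residue p)))

  splits-untwisted⁺ : ∀ g {c} S → c ≢ D → Splits (slice S g) (block C c) → Splits S (coverBlock (combine g c))
  splits-untwisted⁺ g {c} S c≢D (meets , meets∁) =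
    meets-untwisted⁺ g S c≢D meets ,
    meets-untwisted⁺ g (∁ S) c≢D (subst (λ q → Nonempty (block C c ∩ q)) (∁-preimage (combine g) S) meets∁)

  splits-untwisted⁻ : ∀ g {c} S → c ≢ D → Splits S (coverBlock (combine g c)) → Splits (slice S g) (block C c)
  splits-untwisted⁻ g {c} S c≢D (meets , meets∁) =
    meets-untwisted⁻ g S c≢D meets ,
    subst (λ q → Nonempty (block C c ∩ q)) (sym (∁-preimage (combine g) S))
      (meets-untwisted⁻ g (∁ S) c≢D meets∁)

  cover-connected : ∀ {a} → ConnectedExcept C D → d ∈ block C D → a ∈ block C D → a ≢ d → Connected cover
  cover-connected {a} connected d∈D a∈D a≢d S monochromatic = trivial
    where
    colour : Index → Bool
    colour p = does (p ∈? S)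

    slice-trivial : ∀ g → Empty (slice S g) ⊎ Empty (∁ (slice S g))
    slice-trivial g = connected (slice S g) λ c c≢D →
      monochromatic⇒¬splits (monochromatic (combine g c)) ∘′ splits-untwisted⁺ g S c≢D

    colour-copy : ∀ g r → colour (combine g r) ≡ colour (combine g a)
    colour-copy g r = begin
      colour (combine g r)      ≡⟨ ∈?-slice S g r ⟨
      does (r ∈? slice S g)     ≡⟨ trivial⇒∈?-≡ r a (slice-trivial g) ⟩
      does (a ∈? slice S g)     ≡⟨ ∈?-slice S g a ⟩
      colour (combine g a)      ∎
      where open ≡-Reasoning

    colour-prev : ∀ g → colour (combine g a) ≡ colour (combine (prev g) a)
    colour-prev g = trans (monochromatic⇒∈?-≡ (monochromatic (combine g D)) a∈ d∈) (colour-copy (prev g) d)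
      where
      a∈ : combine g a ∈ coverBlock (combine g D)
      a∈ = ∈-combine⁺ g D (incident-combine a∈D (sym (shift-untwisted D a (a≢d ∘′ proj₂))))
      d∈ : combine (prev g) d ∈ coverBlock (combine g D)
      d∈ = ∈-combine⁺ g D (incident-combine d∈D (sym shift-twisted))

    colour-copies : ∀ g → colour (combine g a) ≡ colour (combine (zero {n}) a)
    colour-copies = <-weakInduction (λ g → colour (combine g a) ≡ colour (combine (zero {n}) a)) refl
      (λ i eq → trans (colour-prev (suc i)) eq)

    colour-constant : ∀ p → colour p ≡ colour (combine (zero {n}) a)
    colour-constant p = begin
      colour p                                ≡⟨ cong colour (combine-copy-residue p) ⟨
      colour (combine (copy p) (residue p))   ≡⟨ colour-copy (copy p) (residue p) ⟩
      colour (combine (copy p) a)             ≡⟨ colour-copies (copy p) ⟩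
      colour (combine (zero {n}) a)           ∎
      where open ≡-Reasoning

    trivial : Empty S ⊎ Empty (∁ S)
    trivial with colour (combine (zero {n}) a) in eq
    ... | true = inj₂ λ (p , p∈∁S) →
      contradiction (trans (sym (dec-false (p ∈? S) (x∈∁p⇒x∉p p∈∁S))) (trans (colour-constant p) eq)) λ ()
    ... | false = inj₁ λ (p , p∈S) →
      contradiction (trans (sym (dec-true (p ∈? S) p∈S)) (trans (colour-constant p) eq)) λ ()

  lift : Subset s → Subset (suc n * s)
  lift R = preimage residue R

  ∣lift∣ : ∀ R → ∣ lift R ∣ ≡ suc n * ∣ R ∣
  ∣lift∣ R = ∣tabulate∣≡* (suc n) (lookup R ∘′ residue) λ g →
    cong ∣_∣ (trans (tabulate-cong (λ r → cong (lookup R) (residue-combine g r))) (tabulate∘lookup R))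

  meets-lift : ∀ {i} R → Nonempty (block C (residue i) ∩ R) → Nonempty (coverBlock i ∩ lift R)
  meets-lift {i} R (r , r∈) with x∈p∩q⁻ (block C (residue i)) R r∈
  ... | r∈c , r∈R = pointOver i r ,
    x∈p∩q⁺ (pointOver-∈ r∈c , ∈-preimage⁺ (subst (_∈ R) (sym (residue-pointOver i r)) r∈R))

  lift-blocking : ∀ {R} → IsBlockingSet C R → IsBlockingSet cover (lift R)
  lift-blocking {R} R-blocks i =
    meets-lift R (proj₁ (R-blocks (residue i))) ,
    subst (λ q → Nonempty (coverBlock i ∩ q)) (sym (∁-preimage residue R))
      (meets-lift (∁ R) (proj₂ (R-blocks (residue i))))

  cover-minBlockingSize : (∀ Q → BlockingExcept C D Q → k ≤ ∣ Q ∣) →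
    (R : Subset s) → IsBlockingSet C R → ∣ R ∣ ≡ k → MinBlockingSize cover (suc n * k)
  cover-minBlockingSize lower R R-blocks ∣R∣≡k =
    (lift R , lift-blocking R-blocks , trans (∣lift∣ R) (cong (suc n *_) ∣R∣≡k)) ,
    λ Q Q-blocks → subst (_ ≤_) (cong ∣_∣ (tabulate∘lookup Q)) (*≤∣tabulate∣ (suc n) (lookup Q) λ g →
      lower (slice Q g) λ c c≢D → splits-untwisted⁻ g Q c≢D (Q-blocks (combine g c)))

twisted-cover : (C : Config s) (D d a : Fin s) →
  ConnectedExcept C D → d ∈ block C D → a ∈ block C D → a ≢ d →
  (∀ Q → BlockingExcept C D Q → k ≤ ∣ Q ∣) → (R : Subset s) → IsBlockingSet C R → ∣ R ∣ ≡ k →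
  ∀ n → Σ (Config (suc n * s)) λ C′ → Connected C′ × MinBlockingSize C′ (suc n * k)
twisted-cover C D d a connected d∈D a∈D a≢d lower R R-blocks ∣R∣≡k n =
  cover , cover-connected connected d∈D a∈D a≢d , cover-minBlockingSize lower R R-blocks ∣R∣≡k
  where open TwistedCover C D d n

-- Configurations given by point triples, checked by exhaustive search

triple : Fin n × Fin n × Fin n → Subset n
triple (a , b , c) = ⁅ a ⁆ ∪ ⁅ b ⁆ ∪ ⁅ c ⁆

meets-triple⁺ : {a b c : Fin n} {Q : Subset n} → a ∈ Q ⊎ b ∈ Q ⊎ c ∈ Q → Nonempty (triple (a , b , c) ∩ Q)
meets-triple⁺ {a = a} (inj₁ a∈Q) = a , x∈p∩q⁺ (x∈p∪q⁺ (inj₁ (x∈⁅x⁆ a)) , a∈Q)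
meets-triple⁺ {b = b} (inj₂ (inj₁ b∈Q)) = b , x∈p∩q⁺ (x∈p∪q⁺ (inj₂ (x∈p∪q⁺ (inj₁ (x∈⁅x⁆ b)))) , b∈Q)
meets-triple⁺ {c = c} (inj₂ (inj₂ c∈Q)) = c , x∈p∩q⁺ (x∈p∪q⁺ (inj₂ (x∈p∪q⁺ (inj₂ (x∈⁅x⁆ c)))) , c∈Q)

meets-triple⁻ : {a b c : Fin n} {Q : Subset n} → Nonempty (triple (a , b , c) ∩ Q) → a ∈ Q ⊎ b ∈ Q ⊎ c ∈ Q
meets-triple⁻ {a = a} {b} {c} {Q} (x , x∈) with x∈p∩q⁻ (triple (a , b , c)) Q x∈
... | x∈t , x∈Q with x∈p∪q⁻ ⁅ a ⁆ (⁅ b ⁆ ∪ ⁅ c ⁆) x∈t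
... | inj₁ x∈a = inj₁ (subst (_∈ Q) (x∈⁅y⁆⇒x≡y a x∈a) x∈Q)
... | inj₂ x∈bc with x∈p∪q⁻ ⁅ b ⁆ ⁅ c ⁆ x∈bc
... | inj₁ x∈b = inj₂ (inj₁ (subst (_∈ Q) (x∈⁅y⁆⇒x≡y b x∈b) x∈Q))
... | inj₂ x∈c = inj₂ (inj₂ (subst (_∈ Q) (x∈⁅y⁆⇒x≡y c x∈c) x∈Q))

-- Decided through the three points rather than through ∩ on vectors, which keeps the searches fast.
splits-triple? : (Q : Subset n) (t : Fin n × Fin n × Fin n) → Dec (Splits Q (triple t))
splits-triple? Q (a , b , c) = meets? Q ×-dec meets? (∁ Q)
  where
  meets? : (P : Subset _) → Dec (Nonempty (triple (a , b , c) ∩ P))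
  meets? P = map′ meets-triple⁺ meets-triple⁻ (a ∈? P ⊎-dec b ∈? P ⊎-dec c ∈? P)

allSubsets? : {P : Pred (Subset n) ℓ} → Decidable P → Dec (∀ S → P S)
allSubsets? P? with anySubset? (λ S → ¬? (P? S))
... | yes (S , ¬PS) = no λ ∀P → ¬PS (∀P S)
... | no ¬∃ = yes λ S → decidable-stable (P? S) λ ¬PS → ¬∃ (S , ¬PS)

module TripleSystem (pts : Fin v → Fin v × Fin v × Fin v) where

  blockSize? : Dec (∀ i → ∣ triple (pts i) ∣ ≡ 3)
  blockSize? = all? λ i → ∣ triple (pts i) ∣ ≟ℕ 3

  pointDeg? : Dec (∀ x → blocksThrough (triple ∘′ pts) x ≡ 3)
  pointDeg? = all? λ x → blocksThrough (triple ∘′ pts) x ≟ℕ 3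

  pairCond? : Dec (∀ x y → x ≢ y → blocksThrough₂ (triple ∘′ pts) x y ≤ 1)
  pairCond? = all? λ x → all? λ y → ¬? (x ≟ y) →-dec blocksThrough₂ (triple ∘′ pts) x y ≤? 1

  config : {True blockSize?} → {True pointDeg?} → {True pairCond?} → Config v
  config {b} {p} {q} = record
    { block = triple ∘′ pts ; blockSize = toWitness b ; pointDeg = toWitness p ; pairCond = toWitness q }

  connectedExcept? : ∀ D →
    Dec (∀ S → (∀ c → c ≢ D → ¬ Splits S (triple (pts c))) → Empty S ⊎ Empty (∁ S))
  connectedExcept? D = allSubsets? λ S →
    all? (λ c → ¬? (c ≟ D) →-dec ¬? (splits-triple? S (pts c)))
      →-dec (¬? (nonempty? S) ⊎-dec ¬? (nonempty? (∁ S)))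

  blockingExceptBound? : ∀ D k → Dec (∀ Q → (∀ c → c ≢ D → Splits Q (triple (pts c))) → k ≤ ∣ Q ∣)
  blockingExceptBound? D k = allSubsets? λ Q →
    all? (λ c → ¬? (c ≟ D) →-dec splits-triple? Q (pts c)) →-dec k ≤? ∣ Q ∣

  blocking? : ∀ R → Dec (∀ c → Splits R (triple (pts c)))
  blocking? R = all? λ c → splits-triple? R (pts c)

-- The two base configurations

module TwelvePoint where
  open TripleSystem (lookup
    ( (# 3 , # 4 , # 11) ∷ (# 1 , # 4 , # 7) ∷ (# 4 , # 5 , # 8) ∷ (# 1 , # 8 , # 9) ∷ (# 0 , # 9 , # 11)
    ∷ (# 0 , # 1 , # 5) ∷ (# 5 , # 7 , # 10) ∷ (# 0 , # 2 , # 8) ∷ (# 2 , # 6 , # 7) ∷ (# 3 , # 6 , # 9)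
    ∷ (# 6 , # 10 , # 11) ∷ (# 2 , # 3 , # 10) ∷ []))

  C : Config 12
  C = config

  connected : ConnectedExcept C (# 0)
  connected = from-yes (connectedExcept? (# 0))

  lower : ∀ Q → BlockingExcept C (# 0) Q → 5 ≤ ∣ Q ∣
  lower = from-yes (blockingExceptBound? (# 0) 5)

  R : Subset 12
  R = ⁅ # 0 ⁆ ∪ ⁅ # 3 ⁆ ∪ ⁅ # 6 ⁆ ∪ ⁅ # 7 ⁆ ∪ ⁅ # 8 ⁆

  R-blocks : IsBlockingSet C R
  R-blocks = from-yes (blocking? R)

  covers : ∀ n → Σ (Config (suc n * 12)) λ C′ → Connected C′ × MinBlockingSize C′ (suc n * 5)
  covers = twisted-cover C (# 0) (# 11) (# 3) connected
    (from-yes (# 11 ∈? block C (# 0))) (from-yes (# 3 ∈? block C (# 0))) (λ ()) lower R R-blocks refl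

module TenPoint where
  open TripleSystem (lookup
    ( (# 0 , # 4 , # 7) ∷ (# 1 , # 3 , # 9) ∷ (# 0 , # 1 , # 2) ∷ (# 5 , # 8 , # 9) ∷ (# 2 , # 7 , # 8)
    ∷ (# 0 , # 3 , # 6) ∷ (# 4 , # 6 , # 8) ∷ (# 1 , # 4 , # 5) ∷ (# 2 , # 3 , # 5) ∷ (# 6 , # 7 , # 9) ∷ []))

  C : Config 10
  C = config

  connected : ConnectedExcept C (# 0)
  connected = from-yes (connectedExcept? (# 0))

  lower : ∀ Q → BlockingExcept C (# 0) Q → 4 ≤ ∣ Q ∣
  lower = from-yes (blockingExceptBound? (# 0) 4)

  R : Subset 10
  R = ⁅ # 1 ⁆ ∪ ⁅ # 5 ⁆ ∪ ⁅ # 6 ⁆ ∪ ⁅ # 7 ⁆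

  R-blocks : IsBlockingSet C R
  R-blocks = from-yes (blocking? R)

  covers : ∀ n → Σ (Config (suc n * 10)) λ C′ → Connected C′ × MinBlockingSize C′ (suc n * 4)
  covers = twisted-cover C (# 0) (# 7) (# 0) connected
    (from-yes (# 7 ∈? block C (# 0))) (from-yes (# 0 ∈? block C (# 0))) (λ ()) lower R R-blocks refl

k*4+k≡k*5 : ∀ k → k * 4 + k ≡ k * 5
k*4+k≡k*5 k = trans (+-comm (k * 4) k) (sym (*-suc k 4))

ceil3[k*12]+k≡k*5 : ∀ k → ceil3 (k * 12) + k ≡ k * 5
ceil3[k*12]+k≡k*5 k = begin
  (k * 12 + 2) / 3 + k           ≡⟨ cong (λ x → (x + 2) / 3 + k) (*-assoc k 4 3) ⟨
  (k * 4 * 3 + 2) / 3 + k        ≡⟨ cong (_+ k) (+-distrib-/-∣ˡ 2 (divides-refl (k * 4))) ⟩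
  k * 4 * 3 / 3 + 2 / 3 + k      ≡⟨ cong (λ x → x + 0 + k) (m*n/n≡m (k * 4) 3) ⟩
  k * 4 + 0 + k                  ≡⟨ cong (_+ k) (+-identityʳ (k * 4)) ⟩
  k * 4 + k                      ≡⟨ k*4+k≡k*5 k ⟩
  k * 5                          ∎
  where open ≡-Reasoning

k*4+k≡[k*10]/2 : ∀ k → k * 4 + k ≡ k * 10 / 2
k*4+k≡[k*10]/2 k = begin
  k * 4 + k      ≡⟨ k*4+k≡k*5 k ⟩
  k * 5          ≡⟨ m*n/n≡m (k * 5) 2 ⟨
  k * 5 * 2 / 2  ≡⟨ cong (_/ 2) (*-assoc k 5 2) ⟩
  k * 10 / 2     ∎
  where open ≡-Reasoning

corollary8 : (k : ℕ) → 1 ≤ k →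
    (Σ ℕ λ v → v > 0 × Σ (Config v) λ C → Connected C × MinBlockingSize C (ceil3 v + k))
    × (Σ ℕ λ v → v > 0 × Σ (Config v) λ C → Connected C × Σ ℕ λ m → m + k ≡ v / 2 × MinBlockingSize C m)
corollary8 (suc n) _ =
  let C₁ , connected₁ , min₁ = TwelvePoint.covers n
      C₂ , connected₂ , min₂ = TenPoint.covers n
  in (suc n * 12 , s≤s z≤n , C₁ , connected₁ ,
        subst (MinBlockingSize C₁) (sym (ceil3[k*12]+k≡k*5 (suc n))) min₁) ,
     (suc n * 10 , s≤s z≤n , C₂ , connected₂ , suc n * 4 , k*4+k≡[k*10]/2 (suc n) , min₂)
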